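{- For every non-empty index $\boldsymbol{k}$ and every positive integer $m$, \[ g_m(\boldsymbol{k}_{\uparrow};t)=g_m(\boldsymbol{k};t)_{\uparrow}+t\,g_{m-1}(\boldsymbol{k}_{\uparrow};t)_{\uparrow}. \]
   Context: Let $t$ be an indeterminate and $\mathcal{I}^t$ the set of formal $\mathbb{Q}[t]$-linear combinations of indices (tuples of positive integers). For a non-empty index $\boldsymbol{k}=(k_1,\dots,k_r)$, $\boldsymbol{k}_\uparrow=(k_1,\dots,k_{r-1},k_r+1)$; for $w=\sum a_i(t)\boldsymbol{k}_i$ with all $\boldsymbol{k}_i$ non-empty, $w_\uparrow=\sum a_i(t)(\boldsymbol{k}_i)_\uparrow$. Binomial coefficients: for integer $n$ and integer $j\ge0$, $\binom{n}{j}=n(n-1)\cdots(n-j+1)/j!$. For integers $k$, $i\ge0$, $e\ge0$, $f_i(k,e)=\sum_{j=0}^{e}\binom{e-j}{i}\binom{k+e-i-2}{j}t^j(1-t)^{e-i-j}$, and $f_i(k,-1)=0$. For a non-empty index $\boldsymbol{k}=(k_1,\dots,k_r)$ and $m\ge0$, with $k'_j\coloneqq k_j+\delta_{j,1}$, $g_m(\boldsymbol{k};t)=\sum_{l=1}^{r}(-t(1-t))^{r-l}\sum_{(e_1,\dots,e_l)\in\mathbb{Z}_{\ge0}^l,\ \sum e_i=m}\ \sum_{1=i_1<\cdots<i_{l+1}=r+1}\prod_{l'=1}^{l}f_{i_{l'+1}-i_{l'}-1}(k'_{i_{l'}}+\cdots+k'_{i_{l'+1}-1},e_{l'})\cdot(k_{i_1}+\cdots+k_{i_2-1}+e_1,\dots,k_{i_l}+\cdots+k_{i_{l+1}-1}+e_l)$,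 and $g_{ -1}(\boldsymbol{k};t)=0$. -}

module Defs where

open import Data.Nat as ℕ using (ℕ; zero; suc; _≤?_; _!)
open import Data.Nat.Properties using (_!≢0)
import Data.Integer as ℤ
open ℤ using (ℤ)
open import Data.Rational as ℚ using (ℚ; 0ℚ; 1ℚ)
open import Data.List as L using (List; []; _∷_; _++_; map; concatMap; upTo; zipWith; foldr; length)
open import Data.List.Properties using (≡-dec)
open import Data.Product using (_×_; _,_)
open import Relation.Nullary using (yes; no)
open import Relation.Binary.PropositionalEquality using (_≡_)

-- Polynomials in ℚ[t]: coefficient lists (constant term first).

Poly : Set
Poly = List ℚ

coeff : Poly → ℕ → ℚ
coeff []      _       = 0ℚ
coeff (a ∷ p) zero    = a
coeff (a ∷ p) (suc n) = coeff p n

infixl 6 _+ₚ_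
infixl 7 _*ₚ_ _·ₚ_

_+ₚ_ : Poly → Poly → Poly
[]      +ₚ q       = q
(a ∷ p) +ₚ []      = a ∷ p
(a ∷ p) +ₚ (b ∷ q) = (a ℚ.+ b) ∷ (p +ₚ q)

_·ₚ_ : ℚ → Poly → Poly
c ·ₚ p = map (c ℚ.*_) p

_*ₚ_ : Poly → Poly → Poly
[]      *ₚ q = []
(a ∷ p) *ₚ q = (a ·ₚ q) +ₚ (0ℚ ∷ (p *ₚ q))

constₚ : ℚ → Poly
constₚ c = c ∷ []

oneₚ : Poly
oneₚ = constₚ 1ℚ

tₚ : Poly
tₚ = 0ℚ ∷ 1ℚ ∷ []

omtₚ : Poly
omtₚ = 1ℚ ∷ ℚ.- 1ℚ ∷ []

_^ₚ_ : Poly → ℕ → Poly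
p ^ₚ zero  = oneₚ
p ^ₚ suc n = p *ₚ (p ^ₚ n)

sumₚ : List Poly → Poly
sumₚ = foldr _+ₚ_ []

prodₚ : List Poly → Poly
prodₚ = foldr _*ₚ_ oneₚ

falling : ℤ → ℕ → ℤ
falling n zero    = ℤ.+ 1
falling n (suc j) = falling n j ℤ.* (n ℤ.- ℤ.+ j)

binom : ℤ → ℕ → ℚ
binom n j = (falling n j) ℚ./ (j !)
  where instance _ = j !≢0

Index : Set
Index = List ℕ

-- k ↑ : increase the last entry by one (the empty index is left unchanged;
-- it never occurs where ↑ is applied).
_↑ : Index → Index
[]           ↑ = []
(k ∷ [])     ↑ = suc k ∷ []
(k ∷ l ∷ ks) ↑ = k ∷ ((l ∷ ks) ↑)

-- a formal ℚ[t]-linear combination  Σ aᵢ(t) kᵢ, as a list of terms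
LC : Set
LC = List (Poly × Index)

_↑ₗ : LC → LC
w ↑ₗ = map (λ { (a , k) → (a , k ↑) }) w

infixl 6 _⊕_
_⊕_ : LC → LC → LC
_⊕_ = _++_

infixl 7 _⊙_
_⊙_ : Poly → LC → LC
p ⊙ w = map (λ { (a , k) → (p *ₚ a , k) }) w

coeffLC : LC → Index → ℕ → ℚ
coeffLC []             κ n = 0ℚ
coeffLC ((a , k) ∷ w)  κ n with ≡-dec ℕ._≟_ k κ
... | yes _ = coeff a n ℚ.+ coeffLC w κ n
... | no  _ = coeffLC w κ n

-- equality in the free ℚ[t]-module on indices
infix 4 _≋_
_≋_ : LC → LC → Set
w ≋ v = ∀ (κ : Index) (n : ℕ) → coeffLC w κ n ≡ coeffLC v κ n

-- f_i(k,e) for e ≥ 0 :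
--   Σ_{j=0}^{e} C(e-j,i) C(k+e-i-2,j) t^j (1-t)^{e-i-j}
-- Terms with i + j > e have C(e-j,i) = 0 and are omitted
-- (so that the exponent e-i-j is never negative).

fpoly : ℕ → ℤ → ℕ → Poly
fpoly i k e = sumₚ (map term (upTo (suc e)))
  where
  term : ℕ → Poly
  term j with ℕ._≤?_ (i ℕ.+ j) e
  ... | yes _ = (binom (ℤ.+ (e ℕ.∸ j)) i ℚ.* binom (k ℤ.+ ℤ.+ e ℤ.- ℤ.+ i ℤ.- ℤ.+ 2) j)
                  ·ₚ ((tₚ ^ₚ j) *ₚ (omtₚ ^ₚ (e ℕ.∸ i ℕ.∸ j)))
  ... | no  _ = []

-- all ways of cutting an index into l ≥ 0 consecutive non-empty blocks
-- (corresponds to 1 = i₁ < ⋯ < i_{l+1} = r+1)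
splits : Index → List (List Index)
splits []       = [] ∷ []
splits (x ∷ xs) = concatMap ext (splits xs)
  where
  ext : List Index → List (List Index)
  ext []       = ((x ∷ []) ∷ []) ∷ []
  ext (b ∷ bs) = ((x ∷ []) ∷ b ∷ bs) ∷ ((x ∷ b) ∷ bs) ∷ []

comps : ℕ → ℕ → List (List ℕ)
comps zero    zero    = [] ∷ []
comps (suc m) zero    = []
comps m       (suc l) = concatMap (λ e → map (e ∷_) (comps (m ℕ.∸ e) l)) (upTo (suc m))

sumℕ : List ℕ → ℕ
sumℕ = foldr ℕ._+_ 0

-- product over blocks of f_{|block|-1}(sum of k' over block, e);
-- k'_j = k_j + δ_{j,1}, so only the first block gets the extra 1.
fprod : ℕ → List Index → List ℕ → Poly
fprod δ []       _        = oneₚ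
fprod δ (b ∷ bs) []       = oneₚ
fprod δ (b ∷ bs) (e ∷ es) =
  fpoly (length b ℕ.∸ 1) (ℤ.+ (sumℕ b ℕ.+ δ)) e *ₚ fprod 0 bs es

g : ℕ → Index → LC
g m k = concatMap (λ bs → map (term bs) (comps m (length bs))) (splits k)
  where
  r = length k
  c : Poly
  c = ℚ.- 1ℚ ·ₚ (tₚ *ₚ omtₚ)
  term : List Index → List ℕ → Poly × Index
  term bs es = ( (c ^ₚ (r ℕ.∸ length bs)) *ₚ fprod 1 bs es
               , zipWith (λ b e → sumℕ b ℕ.+ e) bs es )

{-# OPTIONS --safe #-}

-- Expand g_m(k) as a sum over the splittings of k into blocks and, for each splitting, over
-- the compositions e of m; a block b contributes the factor f_{|b|-1}(Σb′, e_b) and the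
-- index entry Σb + e_b.  The splittings of k↑ are those of k with the last block raised, so
-- only the last block changes, its sums Σb′ = K and Σb growing by one.  Pascal's rule for the
-- binomial coefficients gives f_i(K + 1, 0) = f_i(K, 0) and
-- f_i(K + 1, e + 1) = f_i(K, e + 1) + t f_i(K + 1, e), while the entry Σb + 1 + e is (Σb + e)↑.
-- The first part reassembles g_m(k)↑ and the second, in which the last e has dropped by one,
-- t g_{m-1}(k↑)↑.  Positivity of the entries of k is never used.

module Submission where

open import Defs
open import Data.Nat as ℕ using (ℕ; zero; suc; pred; _<_; _≤_; _∸_; _≤?_; s≤s; _!)
import Data.Nat.Properties as ℕP
open import Data.Integer as ℤ using (ℤ; +_)
import Data.Integer.Properties as ℤP
open import Data.Integer.Tactic.RingSolver using (solve-∀)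
open import Data.Rational using (ℚ; 0ℚ; 1ℚ; -_; _+_; _*_; _/_; toℚᵘ; fromℚᵘ)
import Data.Rational.Properties as ℚP
import Data.Rational.Unnormalised as ℚᵘ
import Data.Rational.Unnormalised.Properties as ℚᵘP
open import Data.List using (List; []; _∷_; _++_; map; concatMap; upTo; applyUpTo; length; foldr; zipWith)
import Data.List.Properties as LP
open import Data.List.Properties using (≡-dec)
open import Data.List.Relation.Unary.All as All using (All; []; _∷_)
open import Data.List.Relation.Unary.All.Properties using (++⁺; concat⁺; map⁺)
open import Data.Product using (Σ; _×_; _,_; proj₁; proj₂)
open import Data.Sum using (inj₁; inj₂)
open import Data.Empty using (⊥; ⊥-elim)
open import Level using (0ℓ)
open import Relation.Nullary using (¬_; yes; no)
open import Relation.Nullary.Decidable using (toSum)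
open import Relation.Binary.Bundles using (Setoid)
import Relation.Binary.Reasoning.Setoid as SetoidReasoning
open import Relation.Binary.PropositionalEquality
  using (_≡_; _≢_; refl; sym; trans; cong; cong₂; subst; _≗_; module ≡-Reasoning)
open import Algebra.Bundles using (CommutativeMonoid)
open import Algebra.Properties.CommutativeSemigroup
  (CommutativeMonoid.commutativeSemigroup ℚP.+-0-commutativeMonoid) using (interchange)

-- Binomial coefficients

falling-suc : ∀ n j → falling (n ℤ.+ + 1) (suc j) ≡ (n ℤ.+ + 1) ℤ.* falling n j
falling-suc n zero =
  trans (ℤP.*-identityˡ (n ℤ.+ + 1 ℤ.- + 0))
        (trans (ℤP.+-identityʳ (n ℤ.+ + 1)) (sym (ℤP.*-identityʳ (n ℤ.+ + 1))))
falling-suc n (suc j) =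
  trans (cong (ℤ._* (n ℤ.+ + 1 ℤ.- + suc j)) (falling-suc n j)) (reassociate n (falling n j) (+ j))
  where
  reassociate : ∀ n f j → (n ℤ.+ + 1) ℤ.* f ℤ.* ((n ℤ.+ + 1) ℤ.- (+ 1 ℤ.+ j))
                        ≡ (n ℤ.+ + 1) ℤ.* (f ℤ.* (n ℤ.- j))
  reassociate = solve-∀

falling-pascal : ∀ n j → falling (n ℤ.+ + 1) (suc j) ≡ falling n (suc j) ℤ.+ + suc j ℤ.* falling n j
falling-pascal n j = trans (falling-suc n j) (expand n (falling n j) (+ j))
  where
  expand : ∀ n f j → (n ℤ.+ + 1) ℤ.* f ≡ f ℤ.* (n ℤ.- j) ℤ.+ (+ 1 ℤ.+ j) ℤ.* f
  expand = solve-∀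

fromℚᵘ-homo-+ : ∀ p q → fromℚᵘ (p ℚᵘ.+ q) ≡ fromℚᵘ p + fromℚᵘ q
fromℚᵘ-homo-+ p q = ℚP.toℚᵘ-injective (begin
  toℚᵘ (fromℚᵘ (p ℚᵘ.+ q))               ≈⟨ ℚP.toℚᵘ-fromℚᵘ (p ℚᵘ.+ q) ⟩
  p ℚᵘ.+ q                               ≈⟨ ℚᵘP.+-cong (≃-sym (ℚP.toℚᵘ-fromℚᵘ p)) (≃-sym (ℚP.toℚᵘ-fromℚᵘ q)) ⟩
  toℚᵘ (fromℚᵘ p) ℚᵘ.+ toℚᵘ (fromℚᵘ q)  ≈⟨ ≃-sym (ℚP.toℚᵘ-homo-+ (fromℚᵘ p) (fromℚᵘ q)) ⟩
  toℚᵘ (fromℚᵘ p + fromℚᵘ q)             ∎)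
  where
  open SetoidReasoning ℚᵘP.≃-setoid
  open ℚᵘP using (≃-sym)

/-split : ∀ (a b c : ℤ) (s d D : ℕ) → suc D ≡ suc s ℕ.* suc d → a ≡ b ℤ.+ + suc s ℤ.* c →
          a / suc D ≡ b / suc D + c / suc d
/-split a b c s d D D≡ a≡ =
  trans (ℚP.fromℚᵘ-cong {ℚᵘ.mkℚᵘ a D} {ℚᵘ.mkℚᵘ b D ℚᵘ.+ ℚᵘ.mkℚᵘ c d} (ℚᵘ.*≡* cross))
        (fromℚᵘ-homo-+ (ℚᵘ.mkℚᵘ b D) (ℚᵘ.mkℚᵘ c d))
  where
  cross-multiply : ∀ a b c s d e → a ≡ b ℤ.+ s ℤ.* c → e ≡ s ℤ.* d →
                   a ℤ.* (e ℤ.* d) ≡ (b ℤ.* d ℤ.+ c ℤ.* e) ℤ.* e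
  cross-multiply _ b c s d _ refl refl = ring b c s d
    where
    ring : ∀ b c s d → (b ℤ.+ s ℤ.* c) ℤ.* ((s ℤ.* d) ℤ.* d)
                     ≡ (b ℤ.* d ℤ.+ c ℤ.* (s ℤ.* d)) ℤ.* (s ℤ.* d)
    ring = solve-∀
  cross : a ℤ.* + (suc D ℕ.* suc d) ≡ (b ℤ.* + suc d ℤ.+ c ℤ.* + suc D) ℤ.* + suc D
  cross = trans (cong (a ℤ.*_) (ℤP.pos-* (suc D) (suc d)))
                (cross-multiply a b c (+ suc s) (+ suc d) (+ suc D) a≡
                  (trans (cong +_ D≡) (ℤP.pos-* (suc s) (suc d))))

/-suc-pred : ∀ x d .{{_ : ℕ.NonZero d}} → x / d ≡ x / suc (pred d)
/-suc-pred x d = ℚP./-cong {x} {d} {x} {suc (pred d)} refl (sym (ℕP.suc-pred d))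

binom-pascal : ∀ n j → binom (n ℤ.+ + 1) (suc j) ≡ binom n (suc j) + binom n j
binom-pascal n j = begin
  binom (n ℤ.+ + 1) (suc j)
    ≡⟨ /-suc-pred (falling (n ℤ.+ + 1) (suc j)) (suc j !) {{suc j ℕP.!≢0}} ⟩
  falling (n ℤ.+ + 1) (suc j) / suc (pred (suc j !))
    ≡⟨ /-split _ (falling n (suc j)) (falling n j) j (pred (j !)) (pred (suc j !))
               factorial-suc (falling-pascal n j) ⟩
  falling n (suc j) / suc (pred (suc j !)) + falling n j / suc (pred (j !))
    ≡⟨ sym (cong₂ _+_ (/-suc-pred (falling n (suc j)) (suc j !) {{suc j ℕP.!≢0}})
                      (/-suc-pred (falling n j) (j !) {{j ℕP.!≢0}})) ⟩
  binom n (suc j) + binom n j ∎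
  where
  open ≡-Reasoning
  factorial-suc : suc (pred (suc j !)) ≡ suc j ℕ.* suc (pred (j !))
  factorial-suc = trans (ℕP.suc-pred (suc j !) {{suc j ℕP.!≢0}})
                        (cong (suc j ℕ.*_) (sym (ℕP.suc-pred (j !) {{j ℕP.!≢0}})))

-- Coefficient sequences

Series : Set
Series = ℕ → ℚ

shift : Series → Series
shift F zero    = 0ℚ
shift F (suc n) = F n

shift-cong : ∀ {F G} → F ≗ G → shift F ≗ shift G
shift-cong F≗G zero    = refl
shift-cong F≗G (suc n) = F≗G n

shift-zero : shift (λ _ → 0ℚ) ≗ (λ _ → 0ℚ)
shift-zero zero    = refl
shift-zero (suc n) = refl

shift-+ : ∀ F G → shift (λ m → F m + G m) ≗ (λ n → shift F n + shift G n)
shift-+ F G zero    = sym (ℚP.+-identityˡ 0ℚ)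
shift-+ F G (suc n) = refl

shift-scale : ∀ c F → shift (λ m → c * F m) ≗ (λ n → c * shift F n)
shift-scale c F zero    = sym (ℚP.*-zeroʳ c)
shift-scale c F (suc n) = refl

coeff-+ₚ : ∀ p q → coeff (p +ₚ q) ≗ (λ n → coeff p n + coeff q n)
coeff-+ₚ []      q       n       = sym (ℚP.+-identityˡ _)
coeff-+ₚ (a ∷ p) []      n       = sym (ℚP.+-identityʳ _)
coeff-+ₚ (a ∷ p) (b ∷ q) zero    = refl
coeff-+ₚ (a ∷ p) (b ∷ q) (suc n) = coeff-+ₚ p q n

coeff-·ₚ : ∀ c p → coeff (c ·ₚ p) ≗ (λ n → c * coeff p n)
coeff-·ₚ c []      n       = sym (ℚP.*-zeroʳ c)
coeff-·ₚ c (a ∷ p) zero    = refl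
coeff-·ₚ c (a ∷ p) (suc n) = coeff-·ₚ c p n

coeff-0∷ : ∀ p → coeff (0ℚ ∷ p) ≗ shift (coeff p)
coeff-0∷ p zero    = refl
coeff-0∷ p (suc n) = refl

infixr 7 _*ˢ_
_*ˢ_ : Poly → Series → Series
([]      *ˢ F) n = 0ℚ
((a ∷ p) *ˢ F) n = a * F n + shift (p *ˢ F) n

coeff-*ₚ : ∀ p q → coeff (p *ₚ q) ≗ p *ˢ coeff q
coeff-*ₚ []      q n = refl
coeff-*ₚ (a ∷ p) q n =
  trans (coeff-+ₚ (a ·ₚ q) (0ℚ ∷ (p *ₚ q)) n)
        (cong₂ _+_ (coeff-·ₚ a q n) (trans (coeff-0∷ (p *ₚ q) n) (shift-cong (coeff-*ₚ p q) n)))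

*ˢ-congʳ : ∀ p {F G} → F ≗ G → p *ˢ F ≗ p *ˢ G
*ˢ-congʳ []      F≗G n = refl
*ˢ-congʳ (a ∷ p) F≗G n = cong₂ _+_ (cong (a *_) (F≗G n)) (shift-cong (*ˢ-congʳ p F≗G) n)

*ˢ-zeroʳ : ∀ p → p *ˢ (λ _ → 0ℚ) ≗ (λ _ → 0ℚ)
*ˢ-zeroʳ []      n = refl
*ˢ-zeroʳ (a ∷ p) n =
  trans (cong₂ _+_ (ℚP.*-zeroʳ a) (trans (shift-cong (*ˢ-zeroʳ p) n) (shift-zero n)))
        (ℚP.+-identityˡ 0ℚ)

*ˢ-distribˡ-+ : ∀ p F G → p *ˢ (λ m → F m + G m) ≗ (λ n → (p *ˢ F) n + (p *ˢ G) n)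
*ˢ-distribˡ-+ []      F G n = sym (ℚP.+-identityˡ 0ℚ)
*ˢ-distribˡ-+ (a ∷ p) F G n =
  trans (cong₂ _+_ (ℚP.*-distribˡ-+ a (F n) (G n))
                   (trans (shift-cong (*ˢ-distribˡ-+ p F G) n) (shift-+ (p *ˢ F) (p *ˢ G) n)))
        (interchange (a * F n) (a * G n) (shift (p *ˢ F) n) (shift (p *ˢ G) n))

*ˢ-shift : ∀ p F → p *ˢ shift F ≗ shift (p *ˢ F)
*ˢ-shift []      F zero    = refl
*ˢ-shift []      F (suc n) = refl
*ˢ-shift (a ∷ p) F zero    = trans (ℚP.+-identityʳ (a * 0ℚ)) (ℚP.*-zeroʳ a)
*ˢ-shift (a ∷ p) F (suc n) = cong (_+_ (a * F n)) (*ˢ-shift p F n)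

tₚ-*ˢ : ∀ F → tₚ *ˢ F ≗ shift F
tₚ-*ˢ F zero    = trans (ℚP.+-identityʳ (0ℚ * F 0)) (ℚP.*-zeroˡ (F 0))
tₚ-*ˢ F (suc n) =
  trans (cong₂ _+_ (ℚP.*-zeroˡ (F (suc n))) (cong₂ _+_ (ℚP.*-identityˡ (F n)) (shift-zero n)))
        (trans (ℚP.+-identityˡ _) (ℚP.+-identityʳ _))

*ˢ-zeroˡ : ∀ p F → coeff p ≗ (λ _ → 0ℚ) → p *ˢ F ≗ (λ _ → 0ℚ)
*ˢ-zeroˡ []      F p≗0 n = refl
*ˢ-zeroˡ (a ∷ p) F p≗0 n =
  trans (cong₂ _+_ (trans (cong (_* F n) (p≗0 0)) (ℚP.*-zeroˡ (F n)))
                   (trans (shift-cong (*ˢ-zeroˡ p F (λ m → p≗0 (suc m))) n) (shift-zero n)))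
        (ℚP.+-identityˡ 0ℚ)

*ˢ-congˡ : ∀ p q F → coeff p ≗ coeff q → p *ˢ F ≗ q *ˢ F
*ˢ-congˡ []      []      F p≗q n = refl
*ˢ-congˡ []      (b ∷ q) F p≗q n = sym (*ˢ-zeroˡ (b ∷ q) F (λ m → sym (p≗q m)) n)
*ˢ-congˡ (a ∷ p) []      F p≗q n = *ˢ-zeroˡ (a ∷ p) F p≗q n
*ˢ-congˡ (a ∷ p) (b ∷ q) F p≗q n =
  cong₂ _+_ (cong (_* F n) (p≗q 0)) (shift-cong (*ˢ-congˡ p q F (λ m → p≗q (suc m))) n)

coeff-tₚ-*ₚ : ∀ p → coeff (tₚ *ₚ p) ≗ shift (coeff p)
coeff-tₚ-*ₚ p n = trans (coeff-*ₚ tₚ p n) (tₚ-*ˢ (coeff p) n)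

tₚ-*ₚ-*ˢ : ∀ p F → (tₚ *ₚ p) *ˢ F ≗ shift (p *ˢ F)
tₚ-*ₚ-*ˢ p F n =
  trans (*ˢ-congˡ (tₚ *ₚ p) (0ℚ ∷ p) F (λ m → trans (coeff-tₚ-*ₚ p m) (sym (coeff-0∷ p m))) n)
        (trans (cong (_+ shift (p *ˢ F) n) (ℚP.*-zeroˡ (F n))) (ℚP.+-identityˡ _))

coeff-*ₚ-oneₚ : ∀ p → coeff (p *ₚ oneₚ) ≗ coeff p
coeff-*ₚ-oneₚ p n = trans (coeff-*ₚ p oneₚ n) (*ˢ-one p n)
  where
  *ˢ-one : ∀ p → p *ˢ coeff oneₚ ≗ coeff p
  *ˢ-one []      n       = refl
  *ˢ-one (a ∷ p) zero    = trans (ℚP.+-identityʳ _) (ℚP.*-identityʳ a)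
  *ˢ-one (a ∷ p) (suc n) = trans (cong₂ _+_ (ℚP.*-zeroʳ a) (*ˢ-one p n)) (ℚP.+-identityˡ _)

-- The polynomials f_i(k, e)

sumℚ : List ℚ → ℚ
sumℚ = foldr _+_ 0ℚ

coeff-sumₚ : ∀ {A : Set} (term : A → Poly) L n →
             coeff (sumₚ (map term L)) n ≡ sumℚ (map (λ j → coeff (term j) n) L)
coeff-sumₚ term []      n = refl
coeff-sumₚ term (j ∷ L) n =
  trans (coeff-+ₚ (term j) (sumₚ (map term L)) n) (cong (_+_ (coeff (term j) n)) (coeff-sumₚ term L n))

sumℚ-+ : ∀ {A : Set} (f h : A → ℚ) L → sumℚ (map (λ j → f j + h j) L) ≡ sumℚ (map f L) + sumℚ (map h L)
sumℚ-+ f h []      = sym (ℚP.+-identityˡ 0ℚ)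
sumℚ-+ f h (j ∷ L) =
  trans (cong (_+_ (f j + h j)) (sumℚ-+ f h L)) (interchange (f j) (h j) (sumℚ (map f L)) (sumℚ (map h L)))

sumℚ-zero : ∀ {A : Set} (L : List A) → sumℚ (map (λ _ → 0ℚ) L) ≡ 0ℚ
sumℚ-zero []      = refl
sumℚ-zero (j ∷ L) = trans (cong (_+_ 0ℚ) (sumℚ-zero L)) (ℚP.+-identityˡ 0ℚ)

shift-sumℚ : ∀ {A : Set} (G : A → Series) L →
             shift (λ m → sumℚ (map (λ j → G j m) L)) ≗ (λ n → sumℚ (map (λ j → shift (G j) n) L))
shift-sumℚ G L zero    = sym (sumℚ-zero L)
shift-sumℚ G L (suc n) = refl

sumℚ-upTo-suc : ∀ (f : ℕ → ℚ) m → sumℚ (map f (upTo (suc m))) ≡ f 0 + sumℚ (map (λ j → f (suc j)) (upTo m))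
sumℚ-upTo-suc f m = cong (λ L → f 0 + sumℚ L)
  (trans (LP.map-applyUpTo suc f m) (sym (LP.map-applyUpTo (λ i → i) (λ j → f (suc j)) m)))

-- The summand of fpoly is local to its where block; unifying with the definition exposes it.
fpoly-as-sum : ∀ i k e → Σ (ℕ → Poly) (λ term → fpoly i k e ≡ sumₚ (map term (upTo (suc e))))
fpoly-as-sum i k e = _ , refl

fpoly-term : ℕ → ℤ → ℕ → ℕ → Poly
fpoly-term i k e = proj₁ (fpoly-as-sum i k e)

bernstein : ℕ → ℕ → Poly
bernstein j a = (tₚ ^ₚ j) *ₚ (omtₚ ^ₚ a)

fUpper : ℕ → ℤ → ℕ → ℤ
fUpper i k e = k ℤ.+ + e ℤ.- + i ℤ.- + 2

fpoly-term-≤ : ∀ i k e j → i ℕ.+ j ≤ e →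
  fpoly-term i k e j ≡ (binom (+ (e ∸ j)) i * binom (fUpper i k e) j) ·ₚ bernstein j (e ∸ i ∸ j)
fpoly-term-≤ i k e j i+j≤e with i ℕ.+ j ≤? e
... | yes _    = refl
... | no i+j≰e = ⊥-elim (i+j≰e i+j≤e)

fpoly-term-≰ : ∀ i k e j → ¬ (i ℕ.+ j ≤ e) → fpoly-term i k e j ≡ []
fpoly-term-≰ i k e j i+j≰e with i ℕ.+ j ≤? e
... | yes i+j≤e = ⊥-elim (i+j≰e i+j≤e)
... | no _      = refl

fpoly-term-zero : ∀ i k k′ e → fpoly-term i k e 0 ≡ fpoly-term i k′ e 0
fpoly-term-zero i k k′ e with i ℕ.+ 0 ≤? e
... | yes _ = refl
... | no _  = refl

fpoly-zero : ∀ i k k′ → fpoly i k 0 ≡ fpoly i k′ 0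
fpoly-zero i k k′ = cong (_+ₚ []) (fpoly-term-zero i k k′ 0)

coeff-bernstein-suc : ∀ j a → coeff (bernstein (suc j) a) ≗ shift (coeff (bernstein j a))
coeff-bernstein-suc j a n =
  trans (coeff-*ₚ (tₚ *ₚ (tₚ ^ₚ j)) (omtₚ ^ₚ a) n)
        (trans (tₚ-*ₚ-*ˢ (tₚ ^ₚ j) (coeff (omtₚ ^ₚ a)) n)
               (shift-cong (λ m → sym (coeff-*ₚ (tₚ ^ₚ j) (omtₚ ^ₚ a) m)) n))

fUpper-sucʳ : ∀ i k e → fUpper i (ℤ.suc k) (suc e) ≡ fUpper i (ℤ.suc k) e ℤ.+ + 1
fUpper-sucʳ i k e = ring k (+ e) (+ i)
  where
  ring : ∀ k e i → (+ 1 ℤ.+ k) ℤ.+ (+ 1 ℤ.+ e) ℤ.- i ℤ.- + 2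
                 ≡ (+ 1 ℤ.+ k) ℤ.+ e ℤ.- i ℤ.- + 2 ℤ.+ + 1
  ring = solve-∀

fUpper-sucˡ : ∀ i k e → fUpper i k (suc e) ≡ fUpper i (ℤ.suc k) e
fUpper-sucˡ i k e = ring k (+ e) (+ i)
  where
  ring : ∀ k e i → k ℤ.+ (+ 1 ℤ.+ e) ℤ.- i ℤ.- + 2 ≡ (+ 1 ℤ.+ k) ℤ.+ e ℤ.- i ℤ.- + 2
  ring = solve-∀

FpolyTermPascal : ℕ → ℤ → ℕ → ℕ → Set
FpolyTermPascal i k e j =
  coeff (fpoly-term i (ℤ.suc k) (suc e) (suc j))
    ≗ (λ n → coeff (fpoly-term i k (suc e) (suc j)) n + shift (coeff (fpoly-term i (ℤ.suc k) e j)) n)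

fpoly-term-pascal-≤ : ∀ i k e j → i ℕ.+ j ≤ e → FpolyTermPascal i k e j
fpoly-term-pascal-≤ i k e j i+j≤e n = begin
  coeff (fpoly-term i (ℤ.suc k) (suc e) (suc j)) n
    ≡⟨ coeff-term (ℤ.suc k) ⟩
  B * binom (fUpper i (ℤ.suc k) (suc e)) (suc j) * S
    ≡⟨ cong (λ u → B * binom u (suc j) * S) (fUpper-sucʳ i k e) ⟩
  B * binom (N ℤ.+ + 1) (suc j) * S
    ≡⟨ cong (λ b → B * b * S) (binom-pascal N j) ⟩
  B * (binom N (suc j) + binom N j) * S
    ≡⟨ trans (cong (_* S) (ℚP.*-distribˡ-+ B (binom N (suc j)) (binom N j)))
            (ℚP.*-distribʳ-+ S (B * binom N (suc j)) (B * binom N j)) ⟩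
  B * binom N (suc j) * S + B * binom N j * S
    ≡⟨ cong₂ _+_ (trans (cong (λ u → B * binom u (suc j) * S) (sym (fUpper-sucˡ i k e)))
                        (sym (coeff-term k)))
                 (sym lower-term) ⟩
  coeff (fpoly-term i k (suc e) (suc j)) n + shift (coeff (fpoly-term i (ℤ.suc k) e j)) n ∎
  where
  open ≡-Reasoning
  B : ℚ
  B = binom (+ (e ∸ j)) i
  N : ℤ
  N = fUpper i (ℤ.suc k) e
  Y : Poly
  Y = bernstein j (e ∸ i ∸ j)
  S : ℚ
  S = shift (coeff Y) n
  exponent : suc e ∸ i ∸ suc j ≡ e ∸ i ∸ j
  exponent = cong (_∸ suc j) (ℕP.+-∸-assoc 1 (ℕP.≤-trans (ℕP.m≤m+n i j) i+j≤e))
  coeff-term : ∀ k′ → coeff (fpoly-term i k′ (suc e) (suc j)) n ≡ B * binom (fUpper i k′ (suc e)) (suc j) * S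
  coeff-term k′ = begin
    coeff (fpoly-term i k′ (suc e) (suc j)) n
      ≡⟨ cong (λ P → coeff P n)
              (fpoly-term-≤ i k′ (suc e) (suc j) (subst (_≤ suc e) (sym (ℕP.+-suc i j)) (s≤s i+j≤e))) ⟩
    coeff ((B * binom (fUpper i k′ (suc e)) (suc j)) ·ₚ bernstein (suc j) (suc e ∸ i ∸ suc j)) n
      ≡⟨ coeff-·ₚ (B * binom (fUpper i k′ (suc e)) (suc j)) (bernstein (suc j) (suc e ∸ i ∸ suc j)) n ⟩
    B * binom (fUpper i k′ (suc e)) (suc j) * coeff (bernstein (suc j) (suc e ∸ i ∸ suc j)) n
      ≡⟨ cong (λ a → B * binom (fUpper i k′ (suc e)) (suc j) * coeff (bernstein (suc j) a) n) exponent ⟩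
    B * binom (fUpper i k′ (suc e)) (suc j) * coeff (bernstein (suc j) (e ∸ i ∸ j)) n
      ≡⟨ cong (B * binom (fUpper i k′ (suc e)) (suc j) *_) (coeff-bernstein-suc j (e ∸ i ∸ j) n) ⟩
    B * binom (fUpper i k′ (suc e)) (suc j) * S ∎
  lower-term : shift (coeff (fpoly-term i (ℤ.suc k) e j)) n ≡ B * binom N j * S
  lower-term = begin
    shift (coeff (fpoly-term i (ℤ.suc k) e j)) n
      ≡⟨ shift-cong (λ m → cong (λ P → coeff P m) (fpoly-term-≤ i (ℤ.suc k) e j i+j≤e)) n ⟩
    shift (coeff ((B * binom N j) ·ₚ Y)) n
      ≡⟨ shift-cong (coeff-·ₚ (B * binom N j) Y) n ⟩
    shift (λ m → B * binom N j * coeff Y m) n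
      ≡⟨ shift-scale (B * binom N j) (coeff Y) n ⟩
    B * binom N j * S ∎
fpoly-term-pascal-≰ : ∀ i k e j → ¬ (i ℕ.+ j ≤ e) → FpolyTermPascal i k e j
fpoly-term-pascal-≰ i k e j i+j≰e n = begin
  coeff (fpoly-term i (ℤ.suc k) (suc e) (suc j)) n
    ≡⟨ cong (λ P → coeff P n) (fpoly-term-≰ i (ℤ.suc k) (suc e) (suc j) i+sj≰se) ⟩
  0ℚ
    ≡⟨ sym (ℚP.+-identityˡ 0ℚ) ⟩
  0ℚ + 0ℚ
    ≡⟨ sym (cong₂ _+_ (cong (λ P → coeff P n) (fpoly-term-≰ i k (suc e) (suc j) i+sj≰se))
                      (trans (shift-cong (λ m → cong (λ P → coeff P m) (fpoly-term-≰ i (ℤ.suc k) e j i+j≰e)) n)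
                             (shift-zero n))) ⟩
  coeff (fpoly-term i k (suc e) (suc j)) n + shift (coeff (fpoly-term i (ℤ.suc k) e j)) n ∎
  where
  open ≡-Reasoning
  i+sj≰se : ¬ (i ℕ.+ suc j ≤ suc e)
  i+sj≰se i+sj≤se = i+j≰e (ℕP.≤-pred (subst (_≤ suc e) (ℕP.+-suc i j) i+sj≤se))

fpoly-term-pascal : ∀ i k e j → FpolyTermPascal i k e j
fpoly-term-pascal i k e j with toSum (i ℕ.+ j ≤? e)
... | inj₁ i+j≤e = fpoly-term-pascal-≤ i k e j i+j≤e
... | inj₂ i+j≰e = fpoly-term-pascal-≰ i k e j i+j≰e

fpoly-pascal : ∀ i k e →
  coeff (fpoly i (ℤ.suc k) (suc e))
    ≗ (λ n → coeff (fpoly i k (suc e)) n + shift (coeff (fpoly i (ℤ.suc k) e)) n)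
fpoly-pascal i k e n = begin
  coeff (fpoly i (ℤ.suc k) (suc e)) n
    ≡⟨ coeff-sumₚ (fpoly-term i (ℤ.suc k) (suc e)) (upTo (suc (suc e))) n ⟩
  sumℚ (map (λ j → F⁺ j n) (upTo (suc (suc e))))
    ≡⟨ sumℚ-upTo-suc (λ j → F⁺ j n) (suc e) ⟩
  F⁺ 0 n + sumℚ (map (λ j → F⁺ (suc j) n) L)
    ≡⟨ cong₂ _+_ (cong (λ P → coeff P n) (fpoly-term-zero i (ℤ.suc k) k (suc e)))
                 (cong sumℚ (LP.map-cong (λ j → fpoly-term-pascal i k e j n) L)) ⟩
  F 0 n + sumℚ (map (λ j → F (suc j) n + shift (F⁻ j) n) L)
    ≡⟨ cong (_+_ (F 0 n)) (sumℚ-+ (λ j → F (suc j) n) (λ j → shift (F⁻ j) n) L) ⟩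
  F 0 n + (sumℚ (map (λ j → F (suc j) n) L) + sumℚ (map (λ j → shift (F⁻ j) n) L))
    ≡⟨ sym (ℚP.+-assoc (F 0 n) _ _) ⟩
  F 0 n + sumℚ (map (λ j → F (suc j) n) L) + sumℚ (map (λ j → shift (F⁻ j) n) L)
    ≡⟨ cong₂ _+_ (sym (sumℚ-upTo-suc (λ j → F j n) (suc e))) (sym (shift-sumℚ F⁻ L n)) ⟩
  sumℚ (map (λ j → F j n) (upTo (suc (suc e)))) + shift (λ m → sumℚ (map (λ j → F⁻ j m) L)) n
    ≡⟨ sym (cong₂ _+_ (coeff-sumₚ (fpoly-term i k (suc e)) (upTo (suc (suc e))) n)
                      (shift-cong (coeff-sumₚ (fpoly-term i (ℤ.suc k) e) L) n)) ⟩
  coeff (fpoly i k (suc e)) n + shift (coeff (fpoly i (ℤ.suc k) e)) n ∎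
  where
  open ≡-Reasoning
  L : List ℕ
  L = upTo (suc e)
  F⁺ F F⁻ : ℕ → Series
  F⁺ j = coeff (fpoly-term i (ℤ.suc k) (suc e) j)
  F  j = coeff (fpoly-term i k (suc e) j)
  F⁻ j = coeff (fpoly-term i (ℤ.suc k) e j)

-- Linear combinations of indices

coeffLC-match : ∀ a k w κ n → k ≡ κ → coeffLC ((a , k) ∷ w) κ n ≡ coeff a n + coeffLC w κ n
coeffLC-match a k w κ n k≡κ with ≡-dec ℕ._≟_ k κ
... | yes _   = refl
... | no k≢κ  = ⊥-elim (k≢κ k≡κ)

coeffLC-skip : ∀ a k w κ n → k ≢ κ → coeffLC ((a , k) ∷ w) κ n ≡ coeffLC w κ n
coeffLC-skip a k w κ n k≢κ with ≡-dec ℕ._≟_ k κ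
... | yes k≡κ = ⊥-elim (k≢κ k≡κ)
... | no _    = refl

coeffLC-++ : ∀ w v κ n → coeffLC (w ++ v) κ n ≡ coeffLC w κ n + coeffLC v κ n
coeffLC-++ []            v κ n = sym (ℚP.+-identityˡ _)
coeffLC-++ ((a , k) ∷ w) v κ n with ≡-dec ℕ._≟_ k κ
... | yes _ = trans (cong (_+_ (coeff a n)) (coeffLC-++ w v κ n))
                    (sym (ℚP.+-assoc (coeff a n) (coeffLC w κ n) (coeffLC v κ n)))
... | no _  = coeffLC-++ w v κ n

coeffLC-⊙ : ∀ p w κ → coeffLC (p ⊙ w) κ ≗ p *ˢ coeffLC w κ
coeffLC-⊙ p []            κ n = sym (*ˢ-zeroʳ p n)
coeffLC-⊙ p ((a , k) ∷ w) κ n with toSum (≡-dec ℕ._≟_ k κ)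
... | inj₁ k≡κ = begin
  coeffLC (p ⊙ ((a , k) ∷ w)) κ n              ≡⟨ coeffLC-match (p *ₚ a) k (p ⊙ w) κ n k≡κ ⟩
  coeff (p *ₚ a) n + coeffLC (p ⊙ w) κ n        ≡⟨ cong₂ _+_ (coeff-*ₚ p a n) (coeffLC-⊙ p w κ n) ⟩
  (p *ˢ coeff a) n + (p *ˢ coeffLC w κ) n       ≡⟨ sym (*ˢ-distribˡ-+ p (coeff a) (coeffLC w κ) n) ⟩
  (p *ˢ (λ m → coeff a m + coeffLC w κ m)) n    ≡⟨ *ˢ-congʳ p (λ m → sym (coeffLC-match a k w κ m k≡κ)) n ⟩
  (p *ˢ coeffLC ((a , k) ∷ w) κ) n              ∎
  where open ≡-Reasoning
... | inj₂ k≢κ = trans (coeffLC-skip (p *ₚ a) k (p ⊙ w) κ n k≢κ)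
                   (trans (coeffLC-⊙ p w κ n) (*ˢ-congʳ p (λ m → sym (coeffLC-skip a k w κ m k≢κ)) n))

-- _≋_ as a record, so that a proof determines the combinations it relates.
infix 4 _≈_
record _≈_ (w v : LC) : Set where
  constructor mk≈
  field ≈⇒≋ : w ≋ v
open _≈_

≈-refl : ∀ {w} → w ≈ w
≈-refl = mk≈ (λ κ n → refl)

≈-sym : ∀ {w v} → w ≈ v → v ≈ w
≈-sym w≈v = mk≈ (λ κ n → sym (≈⇒≋ w≈v κ n))

≈-trans : ∀ {w v u} → w ≈ v → v ≈ u → w ≈ u
≈-trans w≈v v≈u = mk≈ (λ κ n → trans (≈⇒≋ w≈v κ n) (≈⇒≋ v≈u κ n))

≡⇒≈ : ∀ {w v} → w ≡ v → w ≈ v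
≡⇒≈ refl = ≈-refl

≈-setoid : Setoid 0ℓ 0ℓ
≈-setoid = record
  { Carrier       = LC
  ; _≈_           = _≈_
  ; isEquivalence = record { refl = ≈-refl ; sym = ≈-sym ; trans = ≈-trans }
  }

module ≈-Reasoning = SetoidReasoning ≈-setoid

++-cong : ∀ {w w′ v v′} → w ≈ w′ → v ≈ v′ → w ++ v ≈ w′ ++ v′
++-cong {w} {w′} {v} {v′} w≈w′ v≈v′ = mk≈ (λ κ n →
  trans (coeffLC-++ w v κ n)
        (trans (cong₂ _+_ (≈⇒≋ w≈w′ κ n) (≈⇒≋ v≈v′ κ n)) (sym (coeffLC-++ w′ v′ κ n))))

++-interchange : ∀ a b c d → (a ++ b) ++ (c ++ d) ≈ (a ++ c) ++ (b ++ d)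
++-interchange a b c d = mk≈ (λ κ n → begin
  coeffLC ((a ++ b) ++ (c ++ d)) κ n
    ≡⟨ trans (coeffLC-++ (a ++ b) (c ++ d) κ n) (cong₂ _+_ (coeffLC-++ a b κ n) (coeffLC-++ c d κ n)) ⟩
  (coeffLC a κ n + coeffLC b κ n) + (coeffLC c κ n + coeffLC d κ n)
    ≡⟨ interchange (coeffLC a κ n) (coeffLC b κ n) (coeffLC c κ n) (coeffLC d κ n) ⟩
  (coeffLC a κ n + coeffLC c κ n) + (coeffLC b κ n + coeffLC d κ n)
    ≡⟨ sym (trans (coeffLC-++ (a ++ c) (b ++ d) κ n) (cong₂ _+_ (coeffLC-++ a c κ n) (coeffLC-++ b d κ n))) ⟩
  coeffLC ((a ++ c) ++ (b ++ d)) κ n ∎)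
  where open ≡-Reasoning

⊙-cong : ∀ p {w v} → w ≈ v → p ⊙ w ≈ p ⊙ v
⊙-cong p {w} {v} w≈v = mk≈ (λ κ n →
  trans (coeffLC-⊙ p w κ n) (trans (*ˢ-congʳ p (≈⇒≋ w≈v κ) n) (sym (coeffLC-⊙ p v κ n))))

tₚ-⊙-comm : ∀ p w → tₚ ⊙ (p ⊙ w) ≈ p ⊙ (tₚ ⊙ w)
tₚ-⊙-comm p w = mk≈ (λ κ n → begin
  coeffLC (tₚ ⊙ (p ⊙ w)) κ n          ≡⟨ trans (coeffLC-⊙ tₚ (p ⊙ w) κ n) (tₚ-*ˢ (coeffLC (p ⊙ w) κ) n) ⟩
  shift (coeffLC (p ⊙ w) κ) n         ≡⟨ shift-cong (coeffLC-⊙ p w κ) n ⟩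
  shift (p *ˢ coeffLC w κ) n          ≡⟨ sym (*ˢ-shift p (coeffLC w κ) n) ⟩
  (p *ˢ shift (coeffLC w κ)) n        ≡⟨ *ˢ-congʳ p (λ m → sym (trans (coeffLC-⊙ tₚ w κ m)
                                                                     (tₚ-*ˢ (coeffLC w κ) m))) n ⟩
  (p *ˢ coeffLC (tₚ ⊙ w) κ) n         ≡⟨ sym (coeffLC-⊙ p (tₚ ⊙ w) κ n) ⟩
  coeffLC (p ⊙ (tₚ ⊙ w)) κ n          ∎)
  where open ≡-Reasoning

↑ₗ-++ : ∀ w v → (w ++ v) ↑ₗ ≡ (w ↑ₗ) ++ (v ↑ₗ)
↑ₗ-++ w v = LP.map-++ _ w v

⊙-++ : ∀ p w v → p ⊙ (w ++ v) ≡ (p ⊙ w) ++ (p ⊙ v)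
⊙-++ p w v = LP.map-++ _ w v

↑ₗ-⊙ : ∀ p w → (p ⊙ w) ↑ₗ ≡ p ⊙ (w ↑ₗ)
↑ₗ-⊙ p []            = refl
↑ₗ-⊙ p ((a , k) ∷ w) = cong ((p *ₚ a , k ↑) ∷_) (↑ₗ-⊙ p w)

infixl 6 _↑ₗ⊕tₚ⊙_↑ₗ
_↑ₗ⊕tₚ⊙_↑ₗ : LC → LC → LC
u ↑ₗ⊕tₚ⊙ v ↑ₗ = (u ↑ₗ) ⊕ (tₚ ⊙ (v ↑ₗ))

⊙-↑ₗ⊕tₚ⊙ : ∀ p u v → p ⊙ (u ↑ₗ⊕tₚ⊙ v ↑ₗ) ≈ (p ⊙ u) ↑ₗ⊕tₚ⊙ (p ⊙ v) ↑ₗ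
⊙-↑ₗ⊕tₚ⊙ p u v = begin
  p ⊙ (u ↑ₗ ++ tₚ ⊙ (v ↑ₗ))            ≡⟨ ⊙-++ p (u ↑ₗ) (tₚ ⊙ (v ↑ₗ)) ⟩
  p ⊙ (u ↑ₗ) ++ p ⊙ (tₚ ⊙ (v ↑ₗ))      ≈⟨ ++-cong (≡⇒≈ (sym (↑ₗ-⊙ p u))) (≈-sym (tₚ-⊙-comm p (v ↑ₗ))) ⟩
  (p ⊙ u) ↑ₗ ++ tₚ ⊙ (p ⊙ (v ↑ₗ))      ≡⟨ cong (λ x → (p ⊙ u) ↑ₗ ++ tₚ ⊙ x) (sym (↑ₗ-⊙ p v)) ⟩
  (p ⊙ u) ↑ₗ⊕tₚ⊙ (p ⊙ v) ↑ₗ            ∎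
  where open ≈-Reasoning

++-↑ₗ⊕tₚ⊙ : ∀ u v u′ v′ → (u ↑ₗ⊕tₚ⊙ v ↑ₗ) ++ (u′ ↑ₗ⊕tₚ⊙ v′ ↑ₗ) ≈ (u ++ u′) ↑ₗ⊕tₚ⊙ (v ++ v′) ↑ₗ
++-↑ₗ⊕tₚ⊙ u v u′ v′ = begin
  (u ↑ₗ ++ tₚ ⊙ (v ↑ₗ)) ++ (u′ ↑ₗ ++ tₚ ⊙ (v′ ↑ₗ))   ≈⟨ ++-interchange (u ↑ₗ) (tₚ ⊙ (v ↑ₗ)) (u′ ↑ₗ) (tₚ ⊙ (v′ ↑ₗ)) ⟩
  (u ↑ₗ ++ u′ ↑ₗ) ++ (tₚ ⊙ (v ↑ₗ) ++ tₚ ⊙ (v′ ↑ₗ))   ≡⟨ sym (cong₂ _++_ (↑ₗ-++ u u′)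
                                                             (trans (cong (tₚ ⊙_) (↑ₗ-++ v v′)) (⊙-++ tₚ (v ↑ₗ) (v′ ↑ₗ)))) ⟩
  (u ++ u′) ↑ₗ⊕tₚ⊙ (v ++ v′) ↑ₗ                       ∎
  where open ≈-Reasoning

concatMap-↑ₗ⊕tₚ⊙ : ∀ {A : Set} (U V : A → LC) xs →
  concatMap (λ x → U x ↑ₗ⊕tₚ⊙ V x ↑ₗ) xs ≈ concatMap U xs ↑ₗ⊕tₚ⊙ concatMap V xs ↑ₗ
concatMap-↑ₗ⊕tₚ⊙ U V []       = ≈-refl
concatMap-↑ₗ⊕tₚ⊙ U V (x ∷ xs) =
  ≈-trans (++-cong (≈-refl {U x ↑ₗ⊕tₚ⊙ V x ↑ₗ}) (concatMap-↑ₗ⊕tₚ⊙ U V xs))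
          (++-↑ₗ⊕tₚ⊙ (U x) (V x) (concatMap U xs) (concatMap V xs))

concatMap-cong-≈ : ∀ {A : Set} {f h : A → LC} xs → All (λ x → f x ≈ h x) xs → concatMap f xs ≈ concatMap h xs
concatMap-cong-≈ []       []                = ≈-refl
concatMap-cong-≈ (x ∷ xs) (fx≈hx ∷ f≈h)    = ++-cong fx≈hx (concatMap-cong-≈ xs f≈h)

infixr 5 _∷ₗ_
_∷ₗ_ : ℕ → LC → LC
y ∷ₗ []            = []
y ∷ₗ ((a , k) ∷ w) = (a , y ∷ k) ∷ (y ∷ₗ w)

NonEmptyIndices : LC → Set
NonEmptyIndices = All (λ term → proj₂ term ≢ [])

∷ₗ-nonEmptyIndices : ∀ y w → NonEmptyIndices (y ∷ₗ w)
∷ₗ-nonEmptyIndices y []            = []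
∷ₗ-nonEmptyIndices y ((a , k) ∷ w) = (λ ()) ∷ ∷ₗ-nonEmptyIndices y w

⊙-nonEmptyIndices : ∀ p w → NonEmptyIndices w → NonEmptyIndices (p ⊙ w)
⊙-nonEmptyIndices p []            []         = []
⊙-nonEmptyIndices p ((a , k) ∷ w) (k≢[] ∷ ne) = k≢[] ∷ ⊙-nonEmptyIndices p w ne

∷ₗ-⊙ : ∀ y p w → y ∷ₗ (p ⊙ w) ≡ p ⊙ (y ∷ₗ w)
∷ₗ-⊙ y p []            = refl
∷ₗ-⊙ y p ((a , k) ∷ w) = cong ((p *ₚ a , y ∷ k) ∷_) (∷ₗ-⊙ y p w)

∷ₗ-++ : ∀ y w v → y ∷ₗ (w ++ v) ≡ (y ∷ₗ w) ++ (y ∷ₗ v)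
∷ₗ-++ y []            v = refl
∷ₗ-++ y ((a , k) ∷ w) v = cong ((a , y ∷ k) ∷_) (∷ₗ-++ y w v)

∷ₗ-↑ₗ : ∀ y w → NonEmptyIndices w → y ∷ₗ (w ↑ₗ) ≡ (y ∷ₗ w) ↑ₗ
∷ₗ-↑ₗ y []                 []          = refl
∷ₗ-↑ₗ y ((a , [])     ∷ w) ([]≢[] ∷ _) = ⊥-elim ([]≢[] refl)
∷ₗ-↑ₗ y ((a , k ∷ ks) ∷ w) (_ ∷ ne)    = cong ((a , y ∷ ((k ∷ ks) ↑)) ∷_) (∷ₗ-↑ₗ y w ne)

∷ₗ-↑ₗ⊕tₚ⊙ : ∀ y u v → NonEmptyIndices u → NonEmptyIndices v →
  y ∷ₗ (u ↑ₗ⊕tₚ⊙ v ↑ₗ) ≡ (y ∷ₗ u) ↑ₗ⊕tₚ⊙ (y ∷ₗ v) ↑ₗ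
∷ₗ-↑ₗ⊕tₚ⊙ y u v ne-u ne-v = begin
  y ∷ₗ (u ↑ₗ ++ tₚ ⊙ (v ↑ₗ))          ≡⟨ ∷ₗ-++ y (u ↑ₗ) (tₚ ⊙ (v ↑ₗ)) ⟩
  (y ∷ₗ (u ↑ₗ)) ++ (y ∷ₗ (tₚ ⊙ (v ↑ₗ)))  ≡⟨ cong₂ _++_ (∷ₗ-↑ₗ y u ne-u)
                                                    (trans (∷ₗ-⊙ y tₚ (v ↑ₗ)) (cong (tₚ ⊙_) (∷ₗ-↑ₗ y v ne-v))) ⟩
  (y ∷ₗ u) ↑ₗ⊕tₚ⊙ (y ∷ₗ v) ↑ₗ          ∎
  where open ≡-Reasoning

coeffLC-∷ₗ-[] : ∀ y w n → coeffLC (y ∷ₗ w) [] n ≡ 0ℚ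
coeffLC-∷ₗ-[] y []            n = refl
coeffLC-∷ₗ-[] y ((a , k) ∷ w) n = trans (coeffLC-skip a (y ∷ k) (y ∷ₗ w) [] n (λ ())) (coeffLC-∷ₗ-[] y w n)

coeffLC-∷ₗ-≢ : ∀ y z w κ n → z ≢ y → coeffLC (y ∷ₗ w) (z ∷ κ) n ≡ 0ℚ
coeffLC-∷ₗ-≢ y z []            κ n z≢y = refl
coeffLC-∷ₗ-≢ y z ((a , k) ∷ w) κ n z≢y =
  trans (coeffLC-skip a (y ∷ k) (y ∷ₗ w) (z ∷ κ) n (λ { refl → z≢y refl })) (coeffLC-∷ₗ-≢ y z w κ n z≢y)

coeffLC-∷ₗ : ∀ y w κ → coeffLC (y ∷ₗ w) (y ∷ κ) ≗ coeffLC w κ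
coeffLC-∷ₗ y []            κ n = refl
coeffLC-∷ₗ y ((a , k) ∷ w) κ n with toSum (≡-dec ℕ._≟_ k κ)
... | inj₁ k≡κ = trans (coeffLC-match a (y ∷ k) (y ∷ₗ w) (y ∷ κ) n (cong (y ∷_) k≡κ))
                       (trans (cong (_+_ (coeff a n)) (coeffLC-∷ₗ y w κ n)) (sym (coeffLC-match a k w κ n k≡κ)))
... | inj₂ k≢κ = trans (coeffLC-skip a (y ∷ k) (y ∷ₗ w) (y ∷ κ) n (λ { refl → k≢κ refl }))
                       (trans (coeffLC-∷ₗ y w κ n) (sym (coeffLC-skip a k w κ n k≢κ)))

∷ₗ-cong : ∀ y {w v} → w ≈ v → y ∷ₗ w ≈ y ∷ₗ v
∷ₗ-cong y {w} {v} w≈v = mk≈ coeffs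
  where
  coeffs : y ∷ₗ w ≋ y ∷ₗ v
  coeffs []      n = trans (coeffLC-∷ₗ-[] y w n) (sym (coeffLC-∷ₗ-[] y v n))
  coeffs (z ∷ κ) n with z ℕ.≟ y
  ... | yes refl = trans (coeffLC-∷ₗ y w κ n) (trans (≈⇒≋ w≈v κ n) (sym (coeffLC-∷ₗ y v κ n)))
  ... | no z≢y   = trans (coeffLC-∷ₗ-≢ y z w κ n z≢y) (sym (coeffLC-∷ₗ-≢ y z v κ n z≢y))

Σ-antidiagonal : (ℕ → ℕ → LC) → ℕ → LC
Σ-antidiagonal H zero    = H 0 0
Σ-antidiagonal H (suc m) = H 0 (suc m) ++ Σ-antidiagonal (λ e j → H (suc e) j) m

concatMap-upTo≡Σ-antidiagonal : ∀ H m → concatMap (λ e → H e (m ∸ e)) (upTo (suc m)) ≡ Σ-antidiagonal H m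
concatMap-upTo≡Σ-antidiagonal H zero    = LP.++-identityʳ (H 0 0)
concatMap-upTo≡Σ-antidiagonal H (suc m) = cong (H 0 (suc m) ++_) (begin
  concatMap (λ e → H e (suc m ∸ e)) (applyUpTo suc (suc m))
    ≡⟨ cong (concatMap (λ e → H e (suc m ∸ e))) (sym (LP.map-applyUpTo (λ i → i) suc (suc m))) ⟩
  concatMap (λ e → H e (suc m ∸ e)) (map suc (upTo (suc m)))
    ≡⟨ LP.concatMap-map (λ e → H e (suc m ∸ e)) suc (upTo (suc m)) ⟩
  concatMap (λ e → H (suc e) (m ∸ e)) (upTo (suc m))
    ≡⟨ concatMap-upTo≡Σ-antidiagonal (λ e j → H (suc e) j) m ⟩
  Σ-antidiagonal (λ e j → H (suc e) j) m ∎)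
  where open ≡-Reasoning

Σ-antidiagonal-cong : ∀ {H H′} → (∀ e j → H e j ≈ H′ e j) → ∀ m → Σ-antidiagonal H m ≈ Σ-antidiagonal H′ m
Σ-antidiagonal-cong H≈H′ zero    = H≈H′ 0 0
Σ-antidiagonal-cong H≈H′ (suc m) = ++-cong (H≈H′ 0 (suc m)) (Σ-antidiagonal-cong (λ e j → H≈H′ (suc e) j) m)

Σ-antidiagonal-cong-≡ : ∀ {H H′} → (∀ e j → H e j ≡ H′ e j) → ∀ m → Σ-antidiagonal H m ≡ Σ-antidiagonal H′ m
Σ-antidiagonal-cong-≡ H≡H′ zero    = H≡H′ 0 0
Σ-antidiagonal-cong-≡ H≡H′ (suc m) =
  cong₂ _++_ (H≡H′ 0 (suc m)) (Σ-antidiagonal-cong-≡ (λ e j → H≡H′ (suc e) j) m)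

Σ-antidiagonal-↑ₗ⊕tₚ⊙ : ∀ U V m →
  Σ-antidiagonal (λ e j → U e j ↑ₗ⊕tₚ⊙ V e j ↑ₗ) m ≈ Σ-antidiagonal U m ↑ₗ⊕tₚ⊙ Σ-antidiagonal V m ↑ₗ
Σ-antidiagonal-↑ₗ⊕tₚ⊙ U V zero    = ≈-refl
Σ-antidiagonal-↑ₗ⊕tₚ⊙ U V (suc m) =
  ≈-trans (++-cong (≈-refl {U 0 (suc m) ↑ₗ⊕tₚ⊙ V 0 (suc m) ↑ₗ})
                   (Σ-antidiagonal-↑ₗ⊕tₚ⊙ (λ e j → U (suc e) j) (λ e j → V (suc e) j) m))
          (++-↑ₗ⊕tₚ⊙ (U 0 (suc m)) (V 0 (suc m))
                     (Σ-antidiagonal (λ e j → U (suc e) j) m) (Σ-antidiagonal (λ e j → V (suc e) j) m))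

Σ-antidiagonal-last : ∀ H → (∀ e j → H e (suc j) ≡ []) → ∀ m → Σ-antidiagonal H m ≡ H m 0
Σ-antidiagonal-last H H≡[] zero    = refl
Σ-antidiagonal-last H H≡[] (suc m) =
  trans (cong (_++ Σ-antidiagonal (λ e j → H (suc e) j) m) (H≡[] 0 m))
        (Σ-antidiagonal-last (λ e j → H (suc e) j) (λ e j → H≡[] (suc e) j) m)

-- delayed F m is F (m - 1), with F (-1) = 0 as for g_{-1}.
delayed : (ℕ → LC) → ℕ → LC
delayed F zero    = []
delayed F (suc m) = F m

delayed-cong : ∀ {F G} → F ≗ G → delayed F ≗ delayed G
delayed-cong F≗G zero    = refl
delayed-cong F≗G (suc m) = F≗G m

Σ-antidiagonal-delayed : ∀ H m → Σ-antidiagonal (λ e → delayed (H e)) m ≡ delayed (Σ-antidiagonal H) m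
Σ-antidiagonal-delayed H zero          = refl
Σ-antidiagonal-delayed H (suc zero)    = LP.++-identityʳ (H 0 0)
Σ-antidiagonal-delayed H (suc (suc m)) =
  cong (H 0 (suc m) ++_) (Σ-antidiagonal-delayed (λ e j → H (suc e) j) (suc m))

Σ-antidiagonal-nonEmptyIndices : ∀ H → (∀ e j → NonEmptyIndices (H e j)) → ∀ m →
                                 NonEmptyIndices (Σ-antidiagonal H m)
Σ-antidiagonal-nonEmptyIndices H ne zero    = ne 0 0
Σ-antidiagonal-nonEmptyIndices H ne (suc m) =
  ++⁺ (ne 0 (suc m)) (Σ-antidiagonal-nonEmptyIndices (λ e j → H (suc e) j) (λ e j → ne (suc e) j) m)

-- Block sums

blockFactor : Index → ℕ → ℕ → Poly
blockFactor b δ e = fpoly (length b ∸ 1) (+ (sumℕ b ℕ.+ δ)) e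

blockSum : ℕ → List Index → ℕ → LC
blockSum δ []       zero    = (oneₚ , []) ∷ []
blockSum δ []       (suc m) = []
blockSum δ (b ∷ bs) m       =
  Σ-antidiagonal (λ e j → blockFactor b δ e ⊙ ((sumℕ b ℕ.+ e) ∷ₗ blockSum 0 bs j)) m

blockSum-nonEmptyIndices : ∀ δ b bs m → NonEmptyIndices (blockSum δ (b ∷ bs) m)
blockSum-nonEmptyIndices δ b bs =
  Σ-antidiagonal-nonEmptyIndices _
    (λ e j → ⊙-nonEmptyIndices (blockFactor b δ e) _ (∷ₗ-nonEmptyIndices (sumℕ b ℕ.+ e) (blockSum 0 bs j)))

compositionTerm : ℕ → List Index → List ℕ → Poly × Index
compositionTerm δ bs es = (fprod δ bs es , zipWith (λ b e → sumℕ b ℕ.+ e) bs es)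

map-⊙-∷ₗ : ∀ {A : Set} (p : Poly) (y : ℕ) (f : A → Poly × Index) xs →
  map (λ x → (p *ₚ proj₁ (f x) , y ∷ proj₂ (f x))) xs ≡ p ⊙ (y ∷ₗ map f xs)
map-⊙-∷ₗ p y f []       = refl
map-⊙-∷ₗ p y f (x ∷ xs) = cong (_ ∷_) (map-⊙-∷ₗ p y f xs)

blockSum-compositions : ∀ δ bs m → map (compositionTerm δ bs) (comps m (length bs)) ≡ blockSum δ bs m
blockSum-compositions δ []       zero    = refl
blockSum-compositions δ []       (suc m) = refl
blockSum-compositions δ (b ∷ bs) m       = begin
  map (compositionTerm δ (b ∷ bs)) (comps m (suc (length bs)))
    ≡⟨ cong (map (compositionTerm δ (b ∷ bs))) (comps-suc m) ⟩
  map (compositionTerm δ (b ∷ bs)) (concatMap (λ e → map (e ∷_) (comps (m ∸ e) (length bs))) (upTo (suc m)))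
    ≡⟨ LP.map-concatMap (compositionTerm δ (b ∷ bs)) _ (upTo (suc m)) ⟩
  concatMap (λ e → map (compositionTerm δ (b ∷ bs)) (map (e ∷_) (comps (m ∸ e) (length bs)))) (upTo (suc m))
    ≡⟨ LP.concatMap-cong (λ e → first-block e (m ∸ e)) (upTo (suc m)) ⟩
  concatMap (λ e → H e (m ∸ e)) (upTo (suc m))
    ≡⟨ concatMap-upTo≡Σ-antidiagonal H m ⟩
  blockSum δ (b ∷ bs) m ∎
  where
  open ≡-Reasoning
  H : ℕ → ℕ → LC
  H e j = blockFactor b δ e ⊙ ((sumℕ b ℕ.+ e) ∷ₗ blockSum 0 bs j)
  comps-suc : ∀ m → comps m (suc (length bs))
                  ≡ concatMap (λ e → map (e ∷_) (comps (m ∸ e) (length bs))) (upTo (suc m))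
  comps-suc zero    = refl
  comps-suc (suc m) = refl
  first-block : ∀ e j → map (compositionTerm δ (b ∷ bs)) (map (e ∷_) (comps j (length bs))) ≡ H e j
  first-block e j = begin
    map (compositionTerm δ (b ∷ bs)) (map (e ∷_) (comps j (length bs)))
      ≡⟨ sym (LP.map-∘ (comps j (length bs))) ⟩
    map (λ es → compositionTerm δ (b ∷ bs) (e ∷ es)) (comps j (length bs))
      ≡⟨ map-⊙-∷ₗ (blockFactor b δ e) (sumℕ b ℕ.+ e) (compositionTerm 0 bs) (comps j (length bs)) ⟩
    blockFactor b δ e ⊙ ((sumℕ b ℕ.+ e) ∷ₗ map (compositionTerm 0 bs) (comps j (length bs)))
      ≡⟨ cong (λ w → blockFactor b δ e ⊙ ((sumℕ b ℕ.+ e) ∷ₗ w)) (blockSum-compositions 0 bs j) ⟩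
    H e j ∎

splitWeight : ℕ → Poly
splitWeight n = (- 1ℚ ·ₚ (tₚ *ₚ omtₚ)) ^ₚ n

g-splits : ∀ m k → g m k ≡ concatMap (λ bs → splitWeight (length k ∸ length bs) ⊙ blockSum 1 bs m) (splits k)
g-splits m k = LP.concatMap-cong (λ bs →
  trans (LP.map-∘ (comps m (length bs)))
        (cong (splitWeight (length k ∸ length bs) ⊙_) (blockSum-compositions 1 bs m))) (splits k)

-- Raising the last block

length-↑ : ∀ (k : Index) → length (k ↑) ≡ length k
length-↑ []           = refl
length-↑ (x ∷ [])     = refl
length-↑ (x ∷ y ∷ ks) = cong suc (length-↑ (y ∷ ks))

sumℕ-↑ : ∀ x xs → sumℕ ((x ∷ xs) ↑) ≡ suc (sumℕ (x ∷ xs))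
sumℕ-↑ x []       = refl
sumℕ-↑ x (y ∷ ys) = trans (cong (x ℕ.+_) (sumℕ-↑ y ys)) (ℕP.+-suc x (sumℕ (y ∷ ys)))

raiseLast : List Index → List Index
raiseLast []            = []
raiseLast (b ∷ [])      = (b ↑) ∷ []
raiseLast (b ∷ b′ ∷ bs) = b ∷ raiseLast (b′ ∷ bs)

LastBlockNonEmpty : List Index → Set
LastBlockNonEmpty []            = ⊥
LastBlockNonEmpty (b ∷ [])      = b ≢ []
LastBlockNonEmpty (b ∷ b′ ∷ bs) = LastBlockNonEmpty (b′ ∷ bs)

length-raiseLast : ∀ bs → length (raiseLast bs) ≡ length bs
length-raiseLast []            = refl
length-raiseLast (b ∷ [])      = refl
length-raiseLast (b ∷ b′ ∷ bs) = cong suc (length-raiseLast (b′ ∷ bs))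

raiseLast-blockSum-nonEmptyIndices : ∀ δ b bs m → NonEmptyIndices (blockSum δ (raiseLast (b ∷ bs)) m)
raiseLast-blockSum-nonEmptyIndices δ b []        = blockSum-nonEmptyIndices δ (b ↑) []
raiseLast-blockSum-nonEmptyIndices δ b (b′ ∷ bs) = blockSum-nonEmptyIndices δ b (raiseLast (b′ ∷ bs))

singleBlockSum : ℕ → ℕ → ℕ → ℕ → LC
singleBlockSum i s δ m = (fpoly i (+ (s ℕ.+ δ)) m *ₚ oneₚ , (s ℕ.+ m) ∷ []) ∷ []

blockSum-single : ∀ δ b m → blockSum δ (b ∷ []) m ≡ singleBlockSum (length b ∸ 1) (sumℕ b) δ m
blockSum-single δ b = Σ-antidiagonal-last _ (λ e j → refl)

singleton-split : ∀ p p₁ p₂ κ → coeff p ≗ (λ n → coeff p₁ n + coeff p₂ n) →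
                  (p , κ) ∷ [] ≈ (p₁ , κ) ∷ (p₂ , κ) ∷ []
singleton-split p p₁ p₂ κ p≗p₁+p₂ = mk≈ coeffs
  where
  coeffs : (p , κ) ∷ [] ≋ (p₁ , κ) ∷ (p₂ , κ) ∷ []
  coeffs κ′ n with toSum (≡-dec ℕ._≟_ κ κ′)
  ... | inj₁ κ≡κ′ = begin
    coeffLC ((p , κ) ∷ []) κ′ n                ≡⟨ singleton p ⟩
    coeff p n                                  ≡⟨ p≗p₁+p₂ n ⟩
    coeff p₁ n + coeff p₂ n                    ≡⟨ cong (_+_ (coeff p₁ n)) (sym (singleton p₂)) ⟩
    coeff p₁ n + coeffLC ((p₂ , κ) ∷ []) κ′ n  ≡⟨ sym (coeffLC-match p₁ κ ((p₂ , κ) ∷ []) κ′ n κ≡κ′) ⟩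
    coeffLC ((p₁ , κ) ∷ (p₂ , κ) ∷ []) κ′ n    ∎
    where
    open ≡-Reasoning
    singleton : ∀ q → coeffLC ((q , κ) ∷ []) κ′ n ≡ coeff q n
    singleton q = trans (coeffLC-match q κ [] κ′ n κ≡κ′) (ℚP.+-identityʳ (coeff q n))
  ... | inj₂ κ≢κ′ = trans (coeffLC-skip p κ [] κ′ n κ≢κ′)
                          (sym (trans (coeffLC-skip p₁ κ ((p₂ , κ) ∷ []) κ′ n κ≢κ′)
                                      (coeffLC-skip p₂ κ [] κ′ n κ≢κ′)))

singleBlockSum-raise : ∀ i s δ m →
  singleBlockSum i (suc s) δ m ≈ singleBlockSum i s δ m ↑ₗ⊕tₚ⊙ delayed (singleBlockSum i (suc s) δ) m ↑ₗ
singleBlockSum-raise i s δ zero    =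
  ≡⇒≈ (cong (λ f → (f *ₚ oneₚ , suc (s ℕ.+ 0) ∷ []) ∷ []) (fpoly-zero i (+ (suc s ℕ.+ δ)) (+ (s ℕ.+ δ))))
singleBlockSum-raise i s δ (suc m) =
  ≈-trans (singleton-split (f⁺ *ₚ oneₚ) (f *ₚ oneₚ) (tₚ *ₚ (f⁻ *ₚ oneₚ)) (suc (s ℕ.+ suc m) ∷ []) pascal)
          (≡⇒≈ (cong (λ x → (f *ₚ oneₚ , suc (s ℕ.+ suc m) ∷ []) ∷ (tₚ *ₚ (f⁻ *ₚ oneₚ) , suc x ∷ []) ∷ [])
                     (ℕP.+-suc s m)))
  where
  f⁺ f f⁻ : Poly
  f⁺ = fpoly i (+ (suc s ℕ.+ δ)) (suc m)
  f  = fpoly i (+ (s ℕ.+ δ)) (suc m)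
  f⁻ = fpoly i (+ (suc s ℕ.+ δ)) m
  pascal : coeff (f⁺ *ₚ oneₚ) ≗ (λ n → coeff (f *ₚ oneₚ) n + coeff (tₚ *ₚ (f⁻ *ₚ oneₚ)) n)
  pascal n = begin
    coeff (f⁺ *ₚ oneₚ) n                              ≡⟨ coeff-*ₚ-oneₚ f⁺ n ⟩
    coeff f⁺ n                                        ≡⟨ fpoly-pascal i (+ (s ℕ.+ δ)) m n ⟩
    coeff f n + shift (coeff f⁻) n                    ≡⟨ sym (cong₂ _+_ (coeff-*ₚ-oneₚ f n)
                                                                     (trans (coeff-tₚ-*ₚ (f⁻ *ₚ oneₚ) n)
                                                                            (shift-cong (coeff-*ₚ-oneₚ f⁻) n))) ⟩
    coeff (f *ₚ oneₚ) n + coeff (tₚ *ₚ (f⁻ *ₚ oneₚ)) n ∎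
    where open ≡-Reasoning

blockSum-raiseLast : ∀ δ bs → LastBlockNonEmpty bs → ∀ m →
  blockSum δ (raiseLast bs) m ≈ blockSum δ bs m ↑ₗ⊕tₚ⊙ delayed (blockSum δ (raiseLast bs)) m ↑ₗ
blockSum-raiseLast δ ([] ∷ [])       []≢[] m = ⊥-elim ([]≢[] refl)
blockSum-raiseLast δ ((c ∷ cs) ∷ []) _     m = begin
  blockSum δ (raised ∷ []) m
    ≡⟨ blockSum-raised m ⟩
  singleBlockSum i (suc s) δ m
    ≈⟨ singleBlockSum-raise i s δ m ⟩
  singleBlockSum i s δ m ↑ₗ⊕tₚ⊙ delayed (singleBlockSum i (suc s) δ) m ↑ₗ
    ≡⟨ sym (cong₂ _↑ₗ⊕tₚ⊙_↑ₗ (blockSum-single δ (c ∷ cs) m) (delayed-cong blockSum-raised m)) ⟩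
  blockSum δ ((c ∷ cs) ∷ []) m ↑ₗ⊕tₚ⊙ delayed (blockSum δ (raised ∷ [])) m ↑ₗ ∎
  where
  open ≈-Reasoning
  raised : Index
  raised = (c ∷ cs) ↑
  i s : ℕ
  i = length (c ∷ cs) ∸ 1
  s = sumℕ (c ∷ cs)
  blockSum-raised : ∀ m → blockSum δ (raised ∷ []) m ≡ singleBlockSum i (suc s) δ m
  blockSum-raised m = trans (blockSum-single δ raised m)
                            (cong₂ (λ l s → singleBlockSum (l ∸ 1) s δ m) (length-↑ (c ∷ cs)) (sumℕ-↑ c cs))
blockSum-raiseLast δ (b ∷ b′ ∷ bs) ok m = begin
  blockSum δ (b ∷ R′) m
    ≈⟨ Σ-antidiagonal-cong (λ e j → ⊙-cong (F e) (∷ₗ-cong (y e) (blockSum-raiseLast 0 (b′ ∷ bs) ok j))) m ⟩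
  Σ-antidiagonal (λ e j → F e ⊙ (y e ∷ₗ (blockSum 0 R j ↑ₗ⊕tₚ⊙ delayed (blockSum 0 R′) j ↑ₗ))) m
    ≈⟨ Σ-antidiagonal-cong distribute m ⟩
  Σ-antidiagonal (λ e j → F e ⊙ (y e ∷ₗ blockSum 0 R j) ↑ₗ⊕tₚ⊙ F e ⊙ (y e ∷ₗ delayed (blockSum 0 R′) j) ↑ₗ) m
    ≈⟨ Σ-antidiagonal-↑ₗ⊕tₚ⊙ _ _ m ⟩
  blockSum δ (b ∷ R) m ↑ₗ⊕tₚ⊙ Σ-antidiagonal (λ e j → F e ⊙ (y e ∷ₗ delayed (blockSum 0 R′) j)) m ↑ₗ
    ≈⟨ ++-cong ≈-refl (⊙-cong tₚ (≡⇒≈ (cong _↑ₗ tail-delayed))) ⟩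
  blockSum δ (b ∷ R) m ↑ₗ⊕tₚ⊙ delayed (blockSum δ (b ∷ R′)) m ↑ₗ ∎
  where
  open ≈-Reasoning
  R R′ : List Index
  R  = b′ ∷ bs
  R′ = raiseLast R
  F : ℕ → Poly
  F = blockFactor b δ
  y : ℕ → ℕ
  y e = sumℕ b ℕ.+ e
  delayed-nonEmpty : ∀ j → NonEmptyIndices (delayed (blockSum 0 R′) j)
  delayed-nonEmpty zero    = []
  delayed-nonEmpty (suc j) = raiseLast-blockSum-nonEmptyIndices 0 b′ bs j
  distribute : ∀ e j → F e ⊙ (y e ∷ₗ (blockSum 0 R j ↑ₗ⊕tₚ⊙ delayed (blockSum 0 R′) j ↑ₗ))
                     ≈ F e ⊙ (y e ∷ₗ blockSum 0 R j) ↑ₗ⊕tₚ⊙ F e ⊙ (y e ∷ₗ delayed (blockSum 0 R′) j) ↑ₗ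
  distribute e j =
    ≈-trans (≡⇒≈ (cong (F e ⊙_) (∷ₗ-↑ₗ⊕tₚ⊙ (y e) (blockSum 0 R j) (delayed (blockSum 0 R′) j)
                                               (blockSum-nonEmptyIndices 0 b′ bs j) (delayed-nonEmpty j))))
            (⊙-↑ₗ⊕tₚ⊙ (F e) (y e ∷ₗ blockSum 0 R j) (y e ∷ₗ delayed (blockSum 0 R′) j))
  delayed-commutes : ∀ e j → F e ⊙ (y e ∷ₗ delayed (blockSum 0 R′) j)
                           ≡ delayed (λ j → F e ⊙ (y e ∷ₗ blockSum 0 R′ j)) j
  delayed-commutes e zero    = refl
  delayed-commutes e (suc j) = refl
  tail-delayed : Σ-antidiagonal (λ e j → F e ⊙ (y e ∷ₗ delayed (blockSum 0 R′) j)) m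
                 ≡ delayed (blockSum δ (b ∷ R′)) m
  tail-delayed = trans (Σ-antidiagonal-cong-≡ delayed-commutes m)
                       (Σ-antidiagonal-delayed (λ e j → F e ⊙ (y e ∷ₗ blockSum 0 R′ j)) m)

extend : ℕ → List Index → List (List Index)
extend x []       = ((x ∷ []) ∷ []) ∷ []
extend x (b ∷ bs) = ((x ∷ []) ∷ b ∷ bs) ∷ ((x ∷ b) ∷ bs) ∷ []

splits-∷ : ∀ x xs → splits (x ∷ xs) ≡ concatMap (extend x) (splits xs)
splits-∷ x xs = LP.concatMap-cong (λ { [] → refl ; (b ∷ bs) → refl }) (splits xs)

extend-lastBlockNonEmpty : ∀ x {bs} → LastBlockNonEmpty bs → All LastBlockNonEmpty (extend x bs)
extend-lastBlockNonEmpty x {b ∷ []}      ok = ok ∷ (λ ()) ∷ []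
extend-lastBlockNonEmpty x {b ∷ b′ ∷ bs} ok = ok ∷ ok ∷ []

extend-raiseLast : ∀ x bs → LastBlockNonEmpty bs → extend x (raiseLast bs) ≡ map raiseLast (extend x bs)
extend-raiseLast x ([] ∷ [])       []≢[] = ⊥-elim ([]≢[] refl)
extend-raiseLast x ((c ∷ cs) ∷ []) _     = refl
extend-raiseLast x (b ∷ b′ ∷ bs)   _     = refl

splits-lastBlockNonEmpty : ∀ x xs → All LastBlockNonEmpty (splits (x ∷ xs))
splits-lastBlockNonEmpty x []       = (λ ()) ∷ []
splits-lastBlockNonEmpty x (y ∷ ys) =
  subst (All LastBlockNonEmpty) (sym (splits-∷ x (y ∷ ys)))
        (concat⁺ (map⁺ (All.map (extend-lastBlockNonEmpty x) (splits-lastBlockNonEmpty y ys))))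

concatMap-cong-All : ∀ {A B : Set} {f h : A → List B} xs → All (λ x → f x ≡ h x) xs →
                     concatMap f xs ≡ concatMap h xs
concatMap-cong-All []       []                = refl
concatMap-cong-All (x ∷ xs) (fx≡hx ∷ f≡h)     = cong₂ _++_ fx≡hx (concatMap-cong-All xs f≡h)

splits-↑ : ∀ x xs → splits ((x ∷ xs) ↑) ≡ map raiseLast (splits (x ∷ xs))
splits-↑ x []       = refl
splits-↑ x (y ∷ ys) = begin
  splits (x ∷ ((y ∷ ys) ↑))                        ≡⟨ splits-∷ x ((y ∷ ys) ↑) ⟩
  concatMap (extend x) (splits ((y ∷ ys) ↑))        ≡⟨ cong (concatMap (extend x)) (splits-↑ y ys) ⟩
  concatMap (extend x) (map raiseLast S)            ≡⟨ LP.concatMap-map (extend x) raiseLast S ⟩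
  concatMap (λ bs → extend x (raiseLast bs)) S      ≡⟨ concatMap-cong-All S (All.map (λ {bs} → extend-raiseLast x bs)
                                                                                     (splits-lastBlockNonEmpty y ys)) ⟩
  concatMap (λ bs → map raiseLast (extend x bs)) S  ≡⟨ sym (LP.map-concatMap raiseLast (extend x) S) ⟩
  map raiseLast (concatMap (extend x) S)            ≡⟨ cong (map raiseLast) (sym (splits-∷ x (y ∷ ys))) ⟩
  map raiseLast (splits (x ∷ y ∷ ys))               ∎
  where
  open ≡-Reasoning
  S : List (List Index)
  S = splits (y ∷ ys)

g-↑ : ∀ m x xs → g m ((x ∷ xs) ↑) ≡
  concatMap (λ bs → splitWeight (length (x ∷ xs) ∸ length bs) ⊙ blockSum 1 (raiseLast bs) m) (splits (x ∷ xs))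
g-↑ m x xs = begin
  g m (k ↑)
    ≡⟨ g-splits m (k ↑) ⟩
  concatMap (λ bs → splitWeight (length (k ↑) ∸ length bs) ⊙ blockSum 1 bs m) (splits (k ↑))
    ≡⟨ cong₂ (λ r S → concatMap (λ bs → splitWeight (r ∸ length bs) ⊙ blockSum 1 bs m) S)
             (length-↑ k) (splits-↑ x xs) ⟩
  concatMap (λ bs → splitWeight (length k ∸ length bs) ⊙ blockSum 1 bs m) (map raiseLast (splits k))
    ≡⟨ LP.concatMap-map _ raiseLast (splits k) ⟩
  concatMap (λ bs → splitWeight (length k ∸ length (raiseLast bs)) ⊙ blockSum 1 (raiseLast bs) m) (splits k)
    ≡⟨ LP.concatMap-cong (λ bs → cong (λ l → splitWeight (length k ∸ l) ⊙ blockSum 1 (raiseLast bs) m)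
                                      (length-raiseLast bs)) (splits k) ⟩
  concatMap (λ bs → splitWeight (length k ∸ length bs) ⊙ blockSum 1 (raiseLast bs) m) (splits k) ∎
  where
  open ≡-Reasoning
  k : Index
  k = x ∷ xs

proposition2p2 : (k : Index) → k ≢ [] → All (λ kᵢ → 1 ≤ kᵢ) k →
    (m : ℕ) → 0 < m →
    g m (k ↑) ≋ (g m k ↑ₗ) ⊕ (tₚ ⊙ (g (m ∸ 1) (k ↑) ↑ₗ))
proposition2p2 []       k≢[] _ _       _ = ⊥-elim (k≢[] refl)
proposition2p2 (x ∷ xs) _    _ (suc m) _ = ≈⇒≋ (begin
  g (suc m) (k ↑)
    ≡⟨ g-↑ (suc m) x xs ⟩
  concatMap (λ bs → w bs ⊙ blockSum 1 (raiseLast bs) (suc m)) (splits k)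
    ≈⟨ concatMap-cong-≈ (splits k) (All.map (λ {bs} → raise {bs}) (splits-lastBlockNonEmpty x xs)) ⟩
  concatMap (λ bs → (w bs ⊙ blockSum 1 bs (suc m)) ↑ₗ⊕tₚ⊙ (w bs ⊙ blockSum 1 (raiseLast bs) m) ↑ₗ) (splits k)
    ≈⟨ concatMap-↑ₗ⊕tₚ⊙ _ _ (splits k) ⟩
  concatMap (λ bs → w bs ⊙ blockSum 1 bs (suc m)) (splits k)
    ↑ₗ⊕tₚ⊙ concatMap (λ bs → w bs ⊙ blockSum 1 (raiseLast bs) m) (splits k) ↑ₗ
    ≡⟨ sym (cong₂ _↑ₗ⊕tₚ⊙_↑ₗ (g-splits (suc m) k) (g-↑ m x xs)) ⟩
  g (suc m) k ↑ₗ⊕tₚ⊙ g m (k ↑) ↑ₗ ∎)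
  where
  open ≈-Reasoning
  k : Index
  k = x ∷ xs
  w : List Index → Poly
  w bs = splitWeight (length k ∸ length bs)
  raise : ∀ {bs} → LastBlockNonEmpty bs →
          w bs ⊙ blockSum 1 (raiseLast bs) (suc m)
            ≈ (w bs ⊙ blockSum 1 bs (suc m)) ↑ₗ⊕tₚ⊙ (w bs ⊙ blockSum 1 (raiseLast bs) m) ↑ₗ
  raise {bs} ok = ≈-trans (⊙-cong (w bs) (blockSum-raiseLast 1 bs ok (suc m)))
                          (⊙-↑ₗ⊕tₚ⊙ (w bs) (blockSum 1 bs (suc m)) (blockSum 1 (raiseLast bs) m))
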